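{- Let $k, M$ be non-negative integers such that $k \ge 5$, $M \ge b_k$ and $2^M \ge M - b_k + \nu_2(k!)$. For each $j \in \mathcal{N}_{k,M}$ let $\ell_j$ be a non-negative integer. Suppose that for every integer $n \ge k$ such that $n \equiv j \pmod{2^M}$ for some $j \in \mathcal{N}_{k,M}$, the following two conditions hold for all integers $m \ge M$: (i) $S([n]_{2^m},k)$ is not constant modulo $2^{m-b_k+\ell_j+1}$; (ii) $S([n]_{2^m},k)$ is constant modulo $2^{m-b_k+\ell_j}$. Then for every integer $m \ge M$: (a) the number of integers $n$ with $k \le n < k+2^m$ such that $\nu_2 \circ S(\cdot,k)$ is non-constant on $[n]_{2^m}$ equals $\#\mathcal{N}_{k,M}$; and (b) for every integer $n \ge k$, if $\nu_2\circ S(\cdot,k)$ is non-constant on $[n]_{2^m}$, then $\nu_2\circ S(\cdot,k)$ is non-constant on exactly one of the two classes $[n]_{2^{m+1}}$ and $[n+2^m]_{2^{m+1}}$. In other words, the Amdeberhan–Manna–Moll conjecture holds for $k$ with $\mu_k = \#\mathcal{N}_{k,M}$ and $M_k \le M$.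
   Context: $S(n,k)$ denotes the Stirling number of the second kind (the number of partitions of an $n$-element set into $k$ nonempty blocks); for fixed $k$ it is regarded as a function of $n \ge k$. For a positive integer $z$, $\nu_2(z)=\max\{i\in\mathbb{N}: 2^i \mid z\}$. For $n,t \in \mathbb{N}$, $[n]_t = \{ j \in \mathbb{N} : j \ge \max\{n,t\},\ j \equiv n \pmod t\}$; the classes $[n]_{2^{m+1}}$ and $[n+2^m]_{2^{m+1}}$ are called the children of $[n]_{2^m}$. For a function $f$ and a set $A$ in its domain, $f(A)=\{f(a):a\in A\}$, and $f$ is constant on $A$ if $f(A)$ is a singleton. A set $A$ of integers is constant modulo $Q$ if all its elements are congruent to one another modulo $Q$. $b_k = \lceil \log_2 k\rceil - 2$. For positive integers $k,m$, $\mathcal{N}_{k,m} = \{ n \in \mathbb{N} : k \le n < k+2^m \text{ and } \nu_2\circ S(\cdot,k) \text{ is non-constant on } [n]_{2^m}\}$. The Amdeberhan–Manna–Moll conjecture for $k$ asserts existence of $M_k,\mu_k$ such that for all $m\ge M_k$, there are exactly $\mu_k$ classes $[n]_{2^m}$ on which $\nu_2\circ S(\cdot,k)$ is non-constant, and each such class has exactly one child on which it is non-constant. -}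

module Defs where

open import Data.Nat using (ℕ; zero; suc; _+_; _*_; _∸_; _^_; _≤_; _<_; _⊔_)
open import Data.Nat.DivMod using (_%_; _/_)
open import Data.Nat.Properties using (m^n≢0)
open import Data.Nat.Logarithm using (⌈log₂_⌉)
open import Data.Fin using (Fin)
open import Data.Product using (Σ; ∃; _×_; _,_)
open import Relation.Binary.PropositionalEquality using (_≡_)
open import Relation.Nullary using (¬_)
open import Function.Definitions using (Injective)
open import Function.Bundles using (_⇔_)

S : ℕ → ℕ → ℕ
S zero    zero    = 1
S zero    (suc k) = 0
S (suc n) zero    = 0
S (suc n) (suc k) = suc k * S n (suc k) + S n k

-- 2-adic valuation: ν₂ z = max { i : 2^i ∣ z } for z > 0
-- (computed by repeated halving with fuel z, which suffices since ν₂ z ≤ z;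
--  the value at z = 0 is irrelevant and is 0 here).
ν₂-go : ℕ → ℕ → ℕ
ν₂-go zero    z       = 0
ν₂-go (suc f) zero    = 0
ν₂-go (suc f) (suc z) with suc z % 2
... | zero  = suc (ν₂-go f (suc z / 2))
... | suc _ = 0

ν₂ : ℕ → ℕ
ν₂ z = ν₂-go z z

_≡_[mod2^_] : ℕ → ℕ → ℕ → Set
x ≡ y [mod2^ e ] = _%_ x (2 ^ e) {{m^n≢0 2 e}} ≡ _%_ y (2 ^ e) {{m^n≢0 2 e}}

b : ℕ → ℕ
b k = ⌈log₂ k ⌉ ∸ 2

InClass : ℕ → ℕ → ℕ → Set
InClass m n j = (n ⊔ 2 ^ m ≤ j) × (j ≡ n [mod2^ m ])

ConstantOn : (ℕ → ℕ) → (ℕ → Set) → Set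
ConstantOn f A = Σ ℕ λ v → (∀ a → A a → f a ≡ v) × (Σ ℕ λ a → A a)

-- A is constant modulo 2^e : all elements of A congruent modulo 2^e
-- (here A is the image S([n]_{2^m}, k), so we quantify over the class)
SConstMod : (k m n e : ℕ) → Set
SConstMod k m n e = ∀ a a′ → InClass m n a → InClass m n a′ → S a k ≡ S a′ k [mod2^ e ]

NonConst : (k m n : ℕ) → Set
NonConst k m n = ¬ ConstantOn (λ j → ν₂ (S j k)) (InClass m n)

𝒩 : ℕ → ℕ → ℕ → Set
𝒩 k m n = (k ≤ n) × (n < k + 2 ^ m) × NonConst k m n

HasSize : (ℕ → Set) → ℕ → Set
HasSize P c = Σ (Fin c → ℕ) λ f → Injective _≡_ _≡_ f × (∀ n → P n ⇔ (∃ λ i → f i ≡ n))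

{-# OPTIONS --safe #-}
module Submission where

-- Let ν₂ ∘ S(·,k) be non-constant on [n]_{2^m}, let j ∈ 𝒩_{k,M} be the representative of
-- n modulo 2^M and e = m - b_k + ℓ_j. S is constant modulo 2^e on [n]_{2^m}, and the
-- common residue must be 0: a non-zero residue r < 2^e would force ν₂ ∘ S = ν₂ r.
-- On each child S is constant modulo 2^{e+1} but not modulo 2^{e+2}, so its residue
-- modulo 2^{e+1} is 0 or 2^e, and the two residues differ because the children cover a
-- class of level m on which S is not constant modulo 2^{e+1}. On the child with residue
-- 2^e, ν₂ ∘ S is constantly e; on the child with residue 0, S takes both residues 0 and
-- 2^{e+1} modulo 2^{e+2}, so ν₂ ∘ S is e+1 at some points and differs from e+1 at others.
-- Hence exactly one child is non-constant, and sending each n ∈ 𝒩_{k,m} to that child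
-- is a bijection 𝒩_{k,m} → 𝒩_{k,m+1}.

open import Defs
open import Data.Nat
open import Data.Nat.Properties
open import Data.Nat.DivMod
open import Data.Nat.Divisibility using (divides)
open import Data.Nat.Tactic.RingSolver using (solve-∀)
open import Data.Fin.Base using (Fin)
open import Data.Product using (∃; _×_; _,_; proj₁; proj₂; map₁; map₂)
open import Data.Sum using (_⊎_; inj₁; inj₂; [_,_]′) renaming (map to ⊎-map)
open import Data.Empty using (⊥; ⊥-elim)
open import Function.Base using (_∘_)
open import Function.Bundles using (mk⇔; Equivalence)
open import Relation.Nullary using (¬_; yes; no)
open import Relation.Nullary.Decidable using (decidable-stable)
open import Relation.Binary.PropositionalEquality
open ≡-Reasoning

ν₂-go-zero : ∀ f → ν₂-go f 0 ≡ 0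
ν₂-go-zero zero    = refl
ν₂-go-zero (suc f) = refl

[1+z]/2≤z : ∀ z → suc z / 2 ≤ z
[1+z]/2≤z z = ≤-pred (m/n<m (suc z) 2 (s≤s (s≤s z≤n)))

ν₂-go-fuel-irrelevant : ∀ f g z → z ≤ f → z ≤ g → ν₂-go f z ≡ ν₂-go g z
ν₂-go-fuel-irrelevant f g zero _ _ = trans (ν₂-go-zero f) (sym (ν₂-go-zero g))
ν₂-go-fuel-irrelevant (suc f) (suc g) (suc z) (s≤s z≤f) (s≤s z≤g) with suc z % 2
... | zero  = cong suc (ν₂-go-fuel-irrelevant f g (suc z / 2)
                          (≤-trans ([1+z]/2≤z z) z≤f) (≤-trans ([1+z]/2≤z z) z≤g))
... | suc _ = refl

ν₂-even : ∀ z → suc z % 2 ≡ 0 → ν₂ (suc z) ≡ suc (ν₂ (suc z / 2))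
ν₂-even z even rewrite even =
  cong suc (ν₂-go-fuel-irrelevant z (suc z / 2) (suc z / 2) ([1+z]/2≤z z) ≤-refl)

ν₂-odd : ∀ z w → suc z % 2 ≡ suc w → ν₂ (suc z) ≡ 0
ν₂-odd z w odd rewrite odd = refl

even-or-odd : ∀ r → (∃ λ h → r ≡ 2 * h) ⊎ (∃ λ h → r ≡ 1 + 2 * h)
even-or-odd r with r % 2 | m≡m%n+[m/n]*n r 2 | m%n<n r 2
... | zero        | r≡ | _ = inj₁ (r / 2 , trans r≡ (*-comm (r / 2) 2))
... | suc zero    | r≡ | _ = inj₂ (r / 2 , trans r≡ (cong suc (*-comm (r / 2) 2)))
... | suc (suc _) | _  | s≤s (s≤s ())

ν₂[2*y]≡1+ν₂[y] : ∀ y .{{_ : NonZero y}} → ν₂ (2 * y) ≡ suc (ν₂ y)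
ν₂[2*y]≡1+ν₂[y] (suc y) = trans (ν₂-even _ even) (cong (suc ∘ ν₂) half)
  where
  even : 2 * suc y % 2 ≡ 0
  even = trans (cong (_% 2) (*-comm 2 (suc y))) (m*n%n≡0 (suc y) 2)
  half : 2 * suc y / 2 ≡ suc y
  half = trans (cong (_/ 2) (*-comm 2 (suc y))) (m*n/n≡m (suc y) 2)

ν₂[1+2*q]≡0 : ∀ q → ν₂ (1 + 2 * q) ≡ 0
ν₂[1+2*q]≡0 q = ν₂-odd _ 0 (trans (cong (λ t → suc t % 2) (*-comm 2 q)) ([m+kn]%n≡m%n 1 q 2))

ν₂[2^g*y]≡g+ν₂[y] : ∀ g y .{{_ : NonZero y}} → ν₂ (2 ^ g * y) ≡ g + ν₂ y
ν₂[2^g*y]≡g+ν₂[y] zero    y = cong ν₂ (+-identityʳ y)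
ν₂[2^g*y]≡g+ν₂[y] (suc g) y = begin
  ν₂ (2 * 2 ^ g * y)   ≡⟨ cong ν₂ (*-assoc 2 (2 ^ g) y) ⟩
  ν₂ (2 * (2 ^ g * y)) ≡⟨ ν₂[2*y]≡1+ν₂[y] (2 ^ g * y) {{m*n≢0 (2 ^ g) y {{m^n≢0 2 g}}}} ⟩
  suc (ν₂ (2 ^ g * y)) ≡⟨ cong suc (ν₂[2^g*y]≡g+ν₂[y] g y) ⟩
  suc (g + ν₂ y)       ∎

ν₂[r+2^e*q]≡ν₂[r] : ∀ e r q → 0 < r → r < 2 ^ e → ν₂ (r + 2 ^ e * q) ≡ ν₂ r
ν₂[r+2^e*q]≡ν₂[r] zero r q (s≤s z≤n) (s≤s ())
ν₂[r+2^e*q]≡ν₂[r] (suc e) r q 0<r r<2^e with even-or-odd r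
... | inj₁ (h , refl) = begin
  ν₂ (2 * h + 2 * 2 ^ e * q) ≡⟨ cong ν₂ (double h (2 ^ e) q) ⟩
  ν₂ (2 * (h + 2 ^ e * q))   ≡⟨ ν₂[2*y]≡1+ν₂[y] _ {{>-nonZero (<-≤-trans 0<h (m≤m+n h _))}} ⟩
  suc (ν₂ (h + 2 ^ e * q))   ≡⟨ cong suc (ν₂[r+2^e*q]≡ν₂[r] e h q 0<h (*-cancelˡ-< 2 h (2 ^ e) r<2^e)) ⟩
  suc (ν₂ h)                 ≡⟨ ν₂[2*y]≡1+ν₂[y] h {{>-nonZero 0<h}} ⟨
  ν₂ (2 * h)                 ∎
  where
  0<h : 0 < h
  0<h = n≢0⇒n>0 λ { refl → <-irrefl refl 0<r }
  double : ∀ h a q → 2 * h + 2 * a * q ≡ 2 * (h + a * q)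
  double = solve-∀
... | inj₂ (h , refl) = begin
  ν₂ (1 + 2 * h + 2 * 2 ^ e * q) ≡⟨ cong ν₂ (odd h (2 ^ e) q) ⟩
  ν₂ (1 + 2 * (h + 2 ^ e * q))   ≡⟨ ν₂[1+2*q]≡0 (h + 2 ^ e * q) ⟩
  0                              ≡⟨ ν₂[1+2*q]≡0 h ⟨
  ν₂ (1 + 2 * h)                 ∎
  where
  odd : ∀ h a q → 1 + 2 * h + 2 * a * q ≡ 1 + 2 * (h + a * q)
  odd = solve-∀

infixl 7 _%2^_ _/2^_

_%2^_ : ℕ → ℕ → ℕ
x %2^ e = _%_ x (2 ^ e) {{m^n≢0 2 e}}

_/2^_ : ℕ → ℕ → ℕ
x /2^ e = _/_ x (2 ^ e) {{m^n≢0 2 e}}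

x≡x%2^e+x/2^e*2^e : ∀ x e → x ≡ x %2^ e + x /2^ e * 2 ^ e
x≡x%2^e+x/2^e*2^e x e = m≡m%n+[m/n]*n x (2 ^ e) {{m^n≢0 2 e}}

x%2^e<2^e : ∀ x e → x %2^ e < 2 ^ e
x%2^e<2^e x e = m%n<n x (2 ^ e) {{m^n≢0 2 e}}

x%2^[1+e]%2^e≡x%2^e : ∀ x e → x %2^ suc e %2^ e ≡ x %2^ e
x%2^[1+e]%2^e≡x%2^e x e =
  m∣n⇒o%n%m≡o%m (2 ^ e) (2 ^ suc e) x {{m^n≢0 2 e}} {{m^n≢0 2 (suc e)}} (divides 2 refl)

[n+t*2^m]%2^M≡n%2^M : ∀ n t {M m} → M ≤ m → (n + t * 2 ^ m) %2^ M ≡ n %2^ M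
[n+t*2^m]%2^M≡n%2^M n t {M} {m} M≤m = begin
  (n + t * 2 ^ m) %2^ M                    ≡⟨ cong (λ p → (n + t * p) %2^ M) 2^m≡ ⟩
  (n + t * (2 ^ (m ∸ M) * 2 ^ M)) %2^ M    ≡⟨ cong (λ p → (n + p) %2^ M) (*-assoc t _ _) ⟨
  (n + t * 2 ^ (m ∸ M) * 2 ^ M) %2^ M      ≡⟨ [m+kn]%n≡m%n n (t * 2 ^ (m ∸ M)) (2 ^ M) {{m^n≢0 2 M}} ⟩
  n %2^ M                                  ∎
  where
  2^m≡ : 2 ^ m ≡ 2 ^ (m ∸ M) * 2 ^ M
  2^m≡ = trans (cong (2 ^_) (sym (m∸n+n≡m M≤m))) (^-distribˡ-+-* 2 (m ∸ M) M)

[n+2^m]%2^M≡n%2^M : ∀ n {M m} → M ≤ m → (n + 2 ^ m) %2^ M ≡ n %2^ M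
[n+2^m]%2^M≡n%2^M n {M} {m} M≤m =
  trans (cong (λ p → (n + p) %2^ M) (sym (*-identityˡ (2 ^ m)))) ([n+t*2^m]%2^M≡n%2^M n 1 M≤m)

x%2^e≡0⇒x%2^[1+e]≡0∨2^e : ∀ x e → x %2^ e ≡ 0 → x %2^ suc e ≡ 0 ⊎ x %2^ suc e ≡ 2 ^ e
x%2^e≡0⇒x%2^[1+e]≡0∨2^e x e x%2^e≡0
  with r ← x %2^ suc e | r%2^e≡0 ← trans (x%2^[1+e]%2^e≡x%2^e x e) x%2^e≡0 | r<2^[1+e] ← x%2^e<2^e x (suc e)
  with r /2^ e | x≡x%2^e+x/2^e*2^e r e | m<n*o⇒m/o<n {r} {2} {2 ^ e} {{m^n≢0 2 e}} r<2^[1+e]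
... | zero        | r≡ | _ = inj₁ (trans r≡ (cong (_+ 0) r%2^e≡0))
... | suc zero    | r≡ | _ = inj₂ (trans r≡ (trans (cong (_+ (2 ^ e + 0)) r%2^e≡0) (+-identityʳ (2 ^ e))))
... | suc (suc _) | _  | s≤s (s≤s ())

x%2^[1+f]≡2^f⇒ν₂[x]≡f : ∀ x f → x %2^ suc f ≡ 2 ^ f → ν₂ x ≡ f
x%2^[1+f]≡2^f⇒ν₂[x]≡f x f r≡2^f = begin
  ν₂ x                                    ≡⟨ cong ν₂ (x≡x%2^e+x/2^e*2^e x (suc f)) ⟩
  ν₂ (x %2^ suc f + q * 2 ^ suc f)        ≡⟨ cong (λ r → ν₂ (r + q * 2 ^ suc f)) r≡2^f ⟩
  ν₂ (2 ^ f + q * (2 * 2 ^ f))            ≡⟨ cong ν₂ (factor (2 ^ f) q) ⟩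
  ν₂ (2 ^ f * (1 + 2 * q))                ≡⟨ ν₂[2^g*y]≡g+ν₂[y] f (1 + 2 * q) ⟩
  f + ν₂ (1 + 2 * q)                      ≡⟨ cong (f +_) (ν₂[1+2*q]≡0 q) ⟩
  f + 0                                   ≡⟨ +-identityʳ f ⟩
  f                                       ∎
  where
  q = x /2^ suc f
  factor : ∀ a q → a + q * (2 * a) ≡ a * (1 + 2 * q)
  factor = solve-∀

x%2^f≡0⇒f≤ν₂[x] : ∀ x f → x %2^ f ≡ 0 → x ≡ 0 ⊎ f ≤ ν₂ x
x%2^f≡0⇒f≤ν₂[x] x f r≡0 with x /2^ f | x≡x%2^e+x/2^e*2^e x f
... | zero  | x≡ = inj₁ (trans x≡ (cong (_+ 0) r≡0))
... | suc q | x≡ = inj₂ (subst (f ≤_) (sym ν₂x≡) (m≤m+n f _))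
  where
  ν₂x≡ : ν₂ x ≡ f + ν₂ (suc q)
  ν₂x≡ = begin
    ν₂ x                        ≡⟨ cong ν₂ x≡ ⟩
    ν₂ (x %2^ f + suc q * 2 ^ f) ≡⟨ cong (λ r → ν₂ (r + suc q * 2 ^ f)) r≡0 ⟩
    ν₂ (suc q * 2 ^ f)          ≡⟨ cong ν₂ (*-comm (suc q) (2 ^ f)) ⟩
    ν₂ (2 ^ f * suc q)          ≡⟨ ν₂[2^g*y]≡g+ν₂[y] f (suc q) ⟩
    f + ν₂ (suc q)              ∎

-- The valuation excluded is 1 + e, not 0, because x = 0 is allowed and ν₂ 0 = 0 is junk.
x%2^[2+e]≡0⇒ν₂[x]≢1+e : ∀ x e → x %2^ suc (suc e) ≡ 0 → ν₂ x ≢ suc e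
x%2^[2+e]≡0⇒ν₂[x]≢1+e x e r≡0 ν₂x≡ with x%2^f≡0⇒f≤ν₂[x] x (suc (suc e)) r≡0
... | inj₁ refl = 0≢1+n ν₂x≡
... | inj₂ 2+e≤ = <-irrefl refl (≤-trans 2+e≤ (≤-reflexive ν₂x≡))

x%2^e≢0⇒ν₂[x]≡ν₂[x%2^e] : ∀ x e → x %2^ e ≢ 0 → ν₂ x ≡ ν₂ (x %2^ e)
x%2^e≢0⇒ν₂[x]≡ν₂[x%2^e] x e r≢0 = begin
  ν₂ x                                ≡⟨ cong ν₂ (x≡x%2^e+x/2^e*2^e x e) ⟩
  ν₂ (x %2^ e + x /2^ e * 2 ^ e)      ≡⟨ cong (λ t → ν₂ (x %2^ e + t)) (*-comm (x /2^ e) (2 ^ e)) ⟩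
  ν₂ (x %2^ e + 2 ^ e * (x /2^ e))    ≡⟨ ν₂[r+2^e*q]≡ν₂[r] e _ _ (n≢0⇒n>0 r≢0) (x%2^e<2^e x e) ⟩
  ν₂ (x %2^ e)                        ∎

ConstMod : (ℕ → Set) → (ℕ → ℕ) → ℕ → Set
ConstMod A s e = ∀ a a′ → A a → A a′ → s a ≡ s a′ [mod2^ e ]

ConstModExactly : (ℕ → Set) → (ℕ → ℕ) → ℕ → Set
ConstModExactly A s e = ConstMod A s e × ¬ ConstMod A s (suc e)

ν₂-Constant : (ℕ → Set) → (ℕ → ℕ) → Set
ν₂-Constant A s = ConstantOn (λ a → ν₂ (s a)) A

exactly-one-if-tags-differ : ∀ {x y u v : ℕ} {P₁ P₂ : Set} → x ≢ y →
  (x ≡ u × ¬ P₁) ⊎ (x ≡ v × P₁) → (y ≡ u × ¬ P₂) ⊎ (y ≡ v × P₂) → (¬ P₁ × P₂) ⊎ (P₁ × ¬ P₂)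
exactly-one-if-tags-differ _ (inj₁ (_ , ¬p₁)) (inj₂ (_ , p₂)) = inj₁ (¬p₁ , p₂)
exactly-one-if-tags-differ _ (inj₂ (_ , p₁)) (inj₁ (_ , ¬p₂)) = inj₂ (p₁ , ¬p₂)
exactly-one-if-tags-differ x≢y (inj₁ (x≡u , _)) (inj₁ (y≡u , _)) = ⊥-elim (x≢y (trans x≡u (sym y≡u)))
exactly-one-if-tags-differ x≢y (inj₂ (x≡v , _)) (inj₂ (y≡v , _)) = ⊥-elim (x≢y (trans x≡v (sym y≡v)))

module _ (s : ℕ → ℕ) where

  ν₂-constant-if-residue≢0 : ∀ {A e a₀} → ConstMod A s e → A a₀ → s a₀ %2^ e ≢ 0 →
                             ν₂-Constant A s
  ν₂-constant-if-residue≢0 {A} {e} {a₀} const a₀∈A r≢0 =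
    ν₂ (s a₀ %2^ e) , ν₂≡ , a₀ , a₀∈A
    where
    ν₂≡ : ∀ a → A a → ν₂ (s a) ≡ ν₂ (s a₀ %2^ e)
    ν₂≡ a a∈A = trans (x%2^e≢0⇒ν₂[x]≡ν₂[x%2^e] (s a) e (r≢0 ∘ trans (sym r≡))) (cong ν₂ r≡)
      where r≡ = const a a₀ a∈A a₀∈A

  residue≡0-if-ν₂-nonconstant : ∀ {A e a} → ConstMod A s e → ¬ ν₂-Constant A s → A a →
                                s a %2^ e ≡ 0
  residue≡0-if-ν₂-nonconstant {e = e} const nonconst a∈A =
    decidable-stable (_ ≟ 0) (nonconst ∘ ν₂-constant-if-residue≢0 {e = e} const a∈A)

  ν₂-constant-if-residue≡2^ : ∀ {A e a₀} → ConstMod A s (suc e) → A a₀ →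
                              s a₀ %2^ suc e ≡ 2 ^ e → ν₂-Constant A s
  ν₂-constant-if-residue≡2^ {e = e} {a₀} const a₀∈A r≡2^e =
    e , (λ a a∈A → x%2^[1+f]≡2^f⇒ν₂[x]≡f (s a) e (trans (const a a₀ a∈A a₀∈A) r≡2^e)) , a₀ , a₀∈A

  ν₂-nonconstant-if-residue≡0 : ∀ {A e a₀} → ConstModExactly A s (suc e) → A a₀ →
                                s a₀ %2^ suc e ≡ 0 → ¬ ν₂-Constant A s
  ν₂-nonconstant-if-residue≡0 {A} {e} {a₀} (const , not-const) a₀∈A r≡0 (v , ν₂≡v , _) =
    not-const residues-agree
    where
    residue : ∀ a → A a → s a %2^ suc (suc e) ≡ 0 ⊎ s a %2^ suc (suc e) ≡ 2 ^ suc e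
    residue a a∈A = x%2^e≡0⇒x%2^[1+e]≡0∨2^e (s a) (suc e) (trans (const a a₀ a∈A a₀∈A) r≡0)
    mixed-residues-impossible : ∀ a a′ → A a → A a′ → s a %2^ suc (suc e) ≡ 0 → s a′ %2^ suc (suc e) ≡ 2 ^ suc e → ⊥
    mixed-residues-impossible a a′ a∈A a′∈A r≡0 r′≡2^ = x%2^[2+e]≡0⇒ν₂[x]≢1+e (s a) e r≡0
      (trans (ν₂≡v a a∈A) (trans (sym (ν₂≡v a′ a′∈A)) (x%2^[1+f]≡2^f⇒ν₂[x]≡f (s a′) (suc e) r′≡2^)))
    residues-agree : ConstMod A s (suc (suc e))
    residues-agree a a′ a∈A a′∈A with residue a a∈A | residue a′ a′∈A
    ... | inj₁ r≡ | inj₁ r′≡ = trans r≡ (sym r′≡)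
    ... | inj₂ r≡ | inj₂ r′≡ = trans r≡ (sym r′≡)
    ... | inj₁ r≡ | inj₂ r′≡ = ⊥-elim (mixed-residues-impossible a a′ a∈A a′∈A r≡ r′≡)
    ... | inj₂ r≡ | inj₁ r′≡ = ⊥-elim (mixed-residues-impossible a′ a a′∈A a∈A r′≡ r≡)

  ν₂-constancy-by-residue : ∀ {C e c} → ConstModExactly C s (suc e) → C c → s c %2^ e ≡ 0 →
    (s c %2^ suc e ≡ 0 × ¬ ν₂-Constant C s) ⊎ (s c %2^ suc e ≡ 2 ^ e × ν₂-Constant C s)
  ν₂-constancy-by-residue {e = e} {c} exact c∈C r≡0 with x%2^e≡0⇒x%2^[1+e]≡0∨2^e (s c) e r≡0
  ... | inj₁ r′≡0  = inj₁ (r′≡0 , ν₂-nonconstant-if-residue≡0 {e = e} exact c∈C r′≡0)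
  ... | inj₂ r′≡2^ = inj₂ (r′≡2^ , ν₂-constant-if-residue≡2^ {e = e} (proj₁ exact) c∈C r′≡2^)

  residues-differ-if-union-not-constant : ∀ {Q C₁ C₂ f c₁ c₂} → (∀ a → Q a → C₁ a ⊎ C₂ a) →
    ¬ ConstMod Q s f → ConstMod C₁ s f → ConstMod C₂ s f → C₁ c₁ → C₂ c₂ →
    ¬ s c₁ ≡ s c₂ [mod2^ f ]
  residues-differ-if-union-not-constant {Q} {f = f} {c₁} {c₂}
    cover not-const const₁ const₂ c₁∈C₁ c₂∈C₂ r₁≡r₂ = not-const λ a a′ a∈Q a′∈Q →
      trans (≡r₁ a a∈Q) (sym (≡r₁ a′ a′∈Q))
    where
    ≡r₁ : ∀ a → Q a → s a %2^ f ≡ s c₁ %2^ f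
    ≡r₁ a a∈Q = [ (λ a∈C₁ → const₁ a c₁ a∈C₁ c₁∈C₁)
                , (λ a∈C₂ → trans (const₂ a c₂ a∈C₂ c₂∈C₂) (sym r₁≡r₂)) ]′ (cover a a∈Q)

  ν₂-constant-on-exactly-one : ∀ {A Q C₁ C₂ e c₁ c₂} →
    ConstMod A s e → ¬ ν₂-Constant A s → A c₁ → A c₂ →
    (∀ a → Q a → C₁ a ⊎ C₂ a) → ¬ ConstMod Q s (suc e) →
    ConstModExactly C₁ s (suc e) → C₁ c₁ → ConstModExactly C₂ s (suc e) → C₂ c₂ →
    (¬ ν₂-Constant C₁ s × ν₂-Constant C₂ s) ⊎ (ν₂-Constant C₁ s × ¬ ν₂-Constant C₂ s)
  ν₂-constant-on-exactly-one {A} {Q} {C₁} {C₂} {e} {c₁} {c₂} const nonconst c₁∈A c₂∈A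
    cover not-const exact₁ c₁∈C₁ exact₂ c₂∈C₂ =
    exactly-one-if-tags-differ differ
      (ν₂-constancy-by-residue {e = e} exact₁ c₁∈C₁ (residue≡0 c₁∈A))
      (ν₂-constancy-by-residue {e = e} exact₂ c₂∈C₂ (residue≡0 c₂∈A))
    where
    residue≡0 : ∀ {a} → A a → s a %2^ e ≡ 0
    residue≡0 = residue≡0-if-ν₂-nonconstant {e = e} const nonconst
    differ : s c₁ %2^ suc e ≢ s c₂ %2^ suc e
    differ = residues-differ-if-union-not-constant {Q} {C₁} {C₂} {suc e} cover not-const
               (proj₁ exact₁) (proj₁ exact₂) c₁∈C₁ c₂∈C₂

InClass-member : ∀ m n q → InClass m n (n + suc q * 2 ^ m)
InClass-member m n q =
  ⊔-lub (m≤m+n n _) (≤-trans (m≤m+n (2 ^ m) (q * 2 ^ m)) (m≤n+m _ n)) ,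
  [m+kn]%n≡m%n n (suc q) (2 ^ m) {{m^n≢0 2 m}}

InClass⇒≡n+t*2^m : ∀ m n {a} → InClass m n a → ∃ λ t → a ≡ n + t * 2 ^ m
InClass⇒≡n+t*2^m m n {a} (n⊔2^m≤a , a≡n) = A ∸ N , (begin
  a                                         ≡⟨ x≡x%2^e+x/2^e*2^e a m ⟩
  a %2^ m + A * 2 ^ m                       ≡⟨ cong₂ (λ r q → r + q * 2 ^ m) a≡n (sym (m+[n∸m]≡n N≤A)) ⟩
  n %2^ m + (N + (A ∸ N)) * 2 ^ m           ≡⟨ cong (n %2^ m +_) (*-distribʳ-+ (2 ^ m) N (A ∸ N)) ⟩
  n %2^ m + (N * 2 ^ m + (A ∸ N) * 2 ^ m)   ≡⟨ +-assoc (n %2^ m) _ _ ⟨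
  n %2^ m + N * 2 ^ m + (A ∸ N) * 2 ^ m     ≡⟨ cong (_+ (A ∸ N) * 2 ^ m) (x≡x%2^e+x/2^e*2^e n m) ⟨
  n + (A ∸ N) * 2 ^ m                       ∎)
  where
  A = a /2^ m
  N = n /2^ m
  N≤A : N ≤ A
  N≤A = /-monoˡ-≤ (2 ^ m) {{m^n≢0 2 m}} (≤-trans (m≤m⊔n n (2 ^ m)) n⊔2^m≤a)

InClass-⊆ : ∀ {M m p n a} → M ≤ m → p ≤ n → n ≡ p [mod2^ M ] → InClass m n a → InClass M p a
InClass-⊆ {M} {m} {p} {n} {a} M≤m p≤n n≡p a∈@(n⊔2^m≤a , _) =
  ⊔-lub (≤-trans p≤n (≤-trans (m≤m⊔n n (2 ^ m)) n⊔2^m≤a))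
        (≤-trans (^-monoʳ-≤ 2 M≤m) (≤-trans (m≤n⊔m n (2 ^ m)) n⊔2^m≤a)) ,
  (let t , a≡ = InClass⇒≡n+t*2^m m n a∈ in
   trans (cong (_%2^ M) a≡) (trans ([n+t*2^m]%2^M≡n%2^M n t M≤m) n≡p))

InClass-split : ∀ m n a → InClass m (n + 2 ^ suc m) a →
                InClass (suc m) n a ⊎ InClass (suc m) (n + 2 ^ m) a
InClass-split m n a a∈ with InClass⇒≡n+t*2^m m (n + 2 ^ suc m) a∈
... | t , a≡ with even-or-odd t
...   | inj₁ (h , refl) =
  inj₁ (subst (InClass (suc m) n) (sym (trans a≡ (even n (2 ^ m) h))) (InClass-member (suc m) n h))
  where
  even : ∀ n d h → n + 2 * d + 2 * h * d ≡ n + suc h * (2 * d)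
  even = solve-∀
...   | inj₂ (h , refl) =
  inj₂ (subst (InClass (suc m) (n + 2 ^ m)) (sym (trans a≡ (odd n (2 ^ m) h)))
              (InClass-member (suc m) (n + 2 ^ m) h))
  where
  odd : ∀ n d h → n + 2 * d + (1 + 2 * h) * d ≡ n + d + suc h * (2 * d)
  odd = solve-∀

NonConst-⊆ : ∀ {k M m p n} → M ≤ m → p ≤ n → n ≡ p [mod2^ M ] → NonConst k m n → NonConst k M p
NonConst-⊆ {m = m} {n = n} M≤m p≤n n≡p nonconst (v , ν₂≡v , _) =
  nonconst (v , (λ a a∈ → ν₂≡v a (InClass-⊆ M≤m p≤n n≡p a∈)) , _ , InClass-member m n 0)

k+d+d≡k+2*d : ∀ k d → k + d + d ≡ k + 2 * d
k+d+d≡k+2*d = solve-∀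

window-representative : ∀ k M n → k ≤ n →
  ∃ λ j → k ≤ j × j < k + 2 ^ M × j ≤ n × n ≡ j [mod2^ M ]
window-representative k M n k≤n = k + r , m≤m+n k r , +-monoʳ-< k (x%2^e<2^e (n ∸ k) M) , j≤n , n≡j
  where
  r = (n ∸ k) %2^ M
  q = (n ∸ k) /2^ M
  j≤n : k + r ≤ n
  j≤n = ≤-trans (+-monoʳ-≤ k (m%n≤m (n ∸ k) (2 ^ M) {{m^n≢0 2 M}})) (≤-reflexive (m+[n∸m]≡n k≤n))
  n≡j : n ≡ (k + r) [mod2^ M ]
  n≡j = begin
    n %2^ M                       ≡⟨ cong (_%2^ M) (m+[n∸m]≡n k≤n) ⟨
    (k + (n ∸ k)) %2^ M           ≡⟨ cong (λ x → (k + x) %2^ M) (x≡x%2^e+x/2^e*2^e (n ∸ k) M) ⟩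
    (k + (r + q * 2 ^ M)) %2^ M   ≡⟨ cong (_%2^ M) (+-assoc k r _) ⟨
    (k + r + q * 2 ^ M) %2^ M     ≡⟨ [m+kn]%n≡m%n (k + r) q (2 ^ M) {{m^n≢0 2 M}} ⟩
    (k + r) %2^ M                 ∎

window-shift-down : ∀ k d {y} → k + d ≤ y → y < k + 2 * d → k ≤ y ∸ d × y ∸ d < k + d
window-shift-down k d {y} k+d≤y y<k+2d =
  m+n≤o⇒m≤o∸n k k+d≤y ,
  subst (y ∸ d <_) (m+n∸n≡m (k + d) d)
        (∸-monoˡ-< (subst (y <_) (sym (k+d+d≡k+2*d k d)) y<k+2d) (m+n≤o⇒n≤o k k+d≤y))

ExactConstancy : ℕ → ℕ → (ℕ → ℕ) → Set
ExactConstancy k M ℓ = ∀ j → 𝒩 k M j → ∀ n → k ≤ n → n ≡ j [mod2^ M ] → ∀ m → M ≤ m →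
  (¬ SConstMod k m n (m ∸ b k + ℓ j + 1)) × SConstMod k m n (m ∸ b k + ℓ j)

OneNonConstChild : ℕ → ℕ → ℕ → Set
OneNonConstChild k m n =
  (NonConst k (suc m) n × ¬ NonConst k (suc m) (n + 2 ^ m))
  ⊎ (¬ NonConst k (suc m) n × NonConst k (suc m) (n + 2 ^ m))

one-nonConst-child-of-representative : ∀ {k M ℓ j m n} → b k ≤ M → ExactConstancy k M ℓ →
  𝒩 k M j → k ≤ n → n ≡ j [mod2^ M ] → M ≤ m → NonConst k m n → OneNonConstChild k m n
one-nonConst-child-of-representative {k} {M} {ℓ} {j} {m} {n} bk≤M hyp j∈𝒩 k≤n n≡j M≤m nonconst =
  ⊎-map (map₂ (λ c nc → nc c)) (map₁ (λ c nc → nc c))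
    (ν₂-constant-on-exactly-one s {e = e} (proj₂ (hyp j j∈𝒩 n k≤n n≡j m M≤m)) nonconst
      (InClass-⊆ (n≤1+n m) ≤-refl refl (InClass-member (suc m) n 0))
      (InClass-⊆ (n≤1+n m) (m≤m+n n _) ([n+2^m]%2^M≡n%2^M n {m} ≤-refl)
                 (InClass-member (suc m) (n + 2 ^ m) 0))
      (InClass-split m n) not-const-below
      (exact-child n k≤n n≡j) (InClass-member (suc m) n 0)
      (exact-child (n + 2 ^ m) (≤-trans k≤n (m≤m+n n _)) (shift M≤m))
      (InClass-member (suc m) (n + 2 ^ m) 0))
  where
  s : ℕ → ℕ
  s a = S a k
  e = m ∸ b k + ℓ j
  shift : ∀ {m′} → M ≤ m′ → (n + 2 ^ m′) ≡ j [mod2^ M ]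
  shift M≤m′ = trans ([n+2^m]%2^M≡n%2^M n M≤m′) n≡j
  [1+m]∸b+ℓ≡1+e : suc m ∸ b k + ℓ j ≡ suc e
  [1+m]∸b+ℓ≡1+e = cong (_+ ℓ j) (+-∸-assoc 1 (≤-trans bk≤M M≤m))
  exact-child : ∀ n′ → k ≤ n′ → n′ ≡ j [mod2^ M ] → ConstModExactly (InClass (suc m) n′) s (suc e)
  exact-child n′ k≤n′ n′≡j with hyp j j∈𝒩 n′ k≤n′ n′≡j (suc m) (m≤n⇒m≤1+n M≤m)
  ... | not-const , const =
    subst (ConstMod (InClass (suc m) n′) s) [1+m]∸b+ℓ≡1+e const ,
    subst (λ f → ¬ ConstMod (InClass (suc m) n′) s f)
          (trans (cong (_+ 1) [1+m]∸b+ℓ≡1+e) (+-comm (suc e) 1)) not-const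
  -- [n]_{2^m} may have members below 2^{m+1}, which lie in neither child; the shifted
  -- class [n + 2^{m+1}]_{2^m} is covered by the two children.
  not-const-below : ¬ ConstMod (InClass m (n + 2 ^ suc m)) s (suc e)
  not-const-below = subst (λ f → ¬ ConstMod (InClass m (n + 2 ^ suc m)) s f) (+-comm e 1)
    (proj₁ (hyp j j∈𝒩 (n + 2 ^ suc m) (≤-trans k≤n (m≤m+n n _)) (shift (m≤n⇒m≤1+n M≤m)) m M≤m))

one-nonConst-child : ∀ {k M ℓ} → b k ≤ M → ExactConstancy k M ℓ →
  ∀ {m} → M ≤ m → ∀ n → k ≤ n → NonConst k m n → OneNonConstChild k m n
one-nonConst-child {k} {M} bk≤M hyp M≤m n k≤n nonconst
  with window-representative k M n k≤n
... | j , k≤j , j<k+2^M , j≤n , n≡j =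
  one-nonConst-child-of-representative bk≤M hyp (k≤j , j<k+2^M , NonConst-⊆ M≤m j≤n n≡j nonconst)
    k≤n n≡j M≤m nonconst

HasSize-transport : ∀ {P Q : ℕ → Set} {c} (g : ∀ x → P x → ℕ) →
  (∀ x x∈P → Q (g x x∈P)) →
  (∀ x y x∈P y∈P → g x x∈P ≡ g y y∈P → x ≡ y) →
  (∀ y → Q y → ∃ λ x → P x × (∀ x∈P → g x x∈P ≡ y)) →
  HasSize P c → HasSize Q c
HasSize-transport {P} {Q} {c} g g∈Q g-injective g-onto (f , f-injective , f-enumerates) =
  h , f-injective ∘ g-injective _ _ _ _ , λ y → mk⇔ (to y) (from y)
  where
  f∈P : ∀ i → P (f i)
  f∈P i = Equivalence.from (f-enumerates (f i)) (i , refl)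
  h : Fin c → ℕ
  h i = g (f i) (f∈P i)
  to : ∀ y → Q y → ∃ λ i → h i ≡ y
  to y y∈Q with g-onto y y∈Q
  ... | x , x∈P , gx≡y with Equivalence.to (f-enumerates x) x∈P
  ...   | i , refl = i , gx≡y (f∈P i)
  from : ∀ y → (∃ λ i → h i ≡ y) → Q y
  from _ (i , refl) = g∈Q (f i) (f∈P i)

module _ (k m : ℕ) where

  nonConstChild : ∀ x → OneNonConstChild k m x → ℕ
  nonConstChild x (inj₁ _) = x
  nonConstChild x (inj₂ _) = x + 2 ^ m

  nonConstChild-NonConst : ∀ x (u : OneNonConstChild k m x) → NonConst k (suc m) (nonConstChild x u)
  nonConstChild-NonConst x (inj₁ (nonconst , _)) = nonconst
  nonConstChild-NonConst x (inj₂ (_ , nonconst)) = nonconst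

  nonConstChild≡x : ∀ x → NonConst k (suc m) x → (u : OneNonConstChild k m x) → nonConstChild x u ≡ x
  nonConstChild≡x x _        (inj₁ _)           = refl
  nonConstChild≡x x nonconst (inj₂ (const , _)) = ⊥-elim (const nonconst)

  nonConstChild≡x+2^m : ∀ x → NonConst k (suc m) (x + 2 ^ m) → (u : OneNonConstChild k m x) →
                        nonConstChild x u ≡ x + 2 ^ m
  nonConstChild≡x+2^m x nonconst (inj₁ (_ , const)) = ⊥-elim (const nonconst)
  nonConstChild≡x+2^m x _        (inj₂ _)           = refl

  nonConstChild-window : ∀ x → k ≤ x → x < k + 2 ^ m → (u : OneNonConstChild k m x) →
                         k ≤ nonConstChild x u × nonConstChild x u < k + 2 ^ suc m
  nonConstChild-window x k≤x x< (inj₁ _) =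
    k≤x , <-≤-trans x< (+-monoʳ-≤ k (m≤m+n (2 ^ m) _))
  nonConstChild-window x k≤x x< (inj₂ _) =
    ≤-trans k≤x (m≤m+n x _) , <-≤-trans (+-monoˡ-< (2 ^ m) x<) (≤-reflexive (k+d+d≡k+2*d k (2 ^ m)))

  nonConstChild-injective : ∀ x y → k ≤ x → k ≤ y → x < k + 2 ^ m → y < k + 2 ^ m →
    (u : OneNonConstChild k m x) (v : OneNonConstChild k m y) →
    nonConstChild x u ≡ nonConstChild y v → x ≡ y
  nonConstChild-injective x y _ _ _ _ (inj₁ _) (inj₁ _) x≡y = x≡y
  nonConstChild-injective x y _ _ _ _ (inj₂ _) (inj₂ _) eq = +-cancelʳ-≡ (2 ^ m) x y eq
  nonConstChild-injective x y _ k≤y x< _ (inj₁ _) (inj₂ _) eq =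
    ⊥-elim (<-irrefl refl (<-≤-trans x< (≤-trans (+-monoˡ-≤ (2 ^ m) k≤y) (≤-reflexive (sym eq)))))
  nonConstChild-injective x y k≤x _ _ y< (inj₂ _) (inj₁ _) eq =
    ⊥-elim (<-irrefl refl (<-≤-trans y< (≤-trans (+-monoˡ-≤ (2 ^ m) k≤x) (≤-reflexive eq))))

  HasSize-𝒩-suc : ∀ {c} → (∀ n → k ≤ n → NonConst k m n → OneNonConstChild k m n) →
                  HasSize (𝒩 k m) c → HasSize (𝒩 k (suc m)) c
  HasSize-𝒩-suc one-child = HasSize-transport child child∈𝒩 child-injective child-onto
    where
    choice : ∀ x → 𝒩 k m x → OneNonConstChild k m x
    choice x (k≤x , _ , nonconst) = one-child x k≤x nonconst
    child : ∀ x → 𝒩 k m x → ℕ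
    child x x∈𝒩 = nonConstChild x (choice x x∈𝒩)
    child∈𝒩 : ∀ x x∈𝒩 → 𝒩 k (suc m) (child x x∈𝒩)
    child∈𝒩 x x∈𝒩@(k≤x , x< , _) =
      let k≤child , child< = nonConstChild-window x k≤x x< (choice x x∈𝒩)
      in k≤child , child< , nonConstChild-NonConst x (choice x x∈𝒩)
    child-injective : ∀ x y x∈𝒩 y∈𝒩 → child x x∈𝒩 ≡ child y y∈𝒩 → x ≡ y
    child-injective x y x∈𝒩@(k≤x , x< , _) y∈𝒩@(k≤y , y< , _) =
      nonConstChild-injective x y k≤x k≤y x< y< (choice x x∈𝒩) (choice y y∈𝒩)
    child-onto : ∀ y → 𝒩 k (suc m) y → ∃ λ x → 𝒩 k m x × (∀ x∈𝒩 → child x x∈𝒩 ≡ y)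
    child-onto y (k≤y , y< , nonconst) with y <? k + 2 ^ m
    ... | yes y<′ = y , (k≤y , y<′ , NonConst-⊆ {k} (n≤1+n m) ≤-refl refl nonconst) ,
                    λ y∈𝒩 → nonConstChild≡x y nonconst (choice y y∈𝒩)
    ... | no y≮ = x , (k≤x , x< , NonConst-⊆ {k} (n≤1+n m) (m∸n≤m y (2 ^ m)) y≡x nonconst) ,
                  λ x∈𝒩 → trans (nonConstChild≡x+2^m x nonconst′ (choice x x∈𝒩)) x+2^m≡y
      where
      x = y ∸ 2 ^ m
      k+2^m≤y : k + 2 ^ m ≤ y
      k+2^m≤y = ≮⇒≥ y≮
      x+2^m≡y : x + 2 ^ m ≡ y
      x+2^m≡y = m∸n+n≡m (m+n≤o⇒n≤o k k+2^m≤y)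
      k≤x : k ≤ x
      k≤x = proj₁ (window-shift-down k (2 ^ m) k+2^m≤y y<)
      x< : x < k + 2 ^ m
      x< = proj₂ (window-shift-down k (2 ^ m) k+2^m≤y y<)
      y≡x : y ≡ x [mod2^ m ]
      y≡x = trans (cong (_%2^ m) (sym x+2^m≡y)) ([m+n]%n≡m%n x (2 ^ m) {{m^n≢0 2 m}})
      nonconst′ : NonConst k (suc m) (x + 2 ^ m)
      nonconst′ = subst (NonConst k (suc m)) (sym x+2^m≡y) nonconst

HasSize-𝒩-+ : ∀ k M → (∀ m → M ≤ m → ∀ n → k ≤ n → NonConst k m n → OneNonConstChild k m n) →
              ∀ d {c} → HasSize (𝒩 k M) c → HasSize (𝒩 k (d + M)) c
HasSize-𝒩-+ k M one-child zero    size = size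
HasSize-𝒩-+ k M one-child (suc d) size =
  HasSize-𝒩-suc k (d + M) (one-child (d + M) (m≤n+m M d)) (HasSize-𝒩-+ k M one-child d size)

theorem4p3 : (k M : ℕ) → 5 ≤ k → b k ≤ M → M ∸ b k + ν₂ (k !) ≤ 2 ^ M →
    (ℓ : ℕ → ℕ) →
    (∀ j → 𝒩 k M j → ∀ n → k ≤ n → n ≡ j [mod2^ M ] → ∀ m → M ≤ m →
       (¬ SConstMod k m n (m ∸ b k + ℓ j + 1)) × SConstMod k m n (m ∸ b k + ℓ j)) →
    ∀ m → M ≤ m →
      (∀ c → HasSize (𝒩 k M) c → HasSize (𝒩 k m) c)
      × (∀ n → k ≤ n → NonConst k m n →
           (NonConst k (suc m) n × ¬ NonConst k (suc m) (n + 2 ^ m))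
           ⊎ (¬ NonConst k (suc m) n × NonConst k (suc m) (n + 2 ^ m)))
theorem4p3 k M _ bk≤M _ ℓ hyp m M≤m =
  (λ c size → subst (λ m′ → HasSize (𝒩 k m′) c) (m∸n+n≡m M≤m) (HasSize-𝒩-+ k M one-child (m ∸ M) size)) ,
  one-child m M≤m
  where
  one-child : ∀ m′ → M ≤ m′ → ∀ n → k ≤ n → NonConst k m′ n → OneNonConstChild k m′ n
  one-child m′ = one-nonConst-child bk≤M hyp {m′}
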